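{- Let $m\ge 3$ and let $(f_0,f_1,f_2)$ be the coloring defined below. Parameterize $P_0=\{S=0\}$ by $(i,k)\in\mathbb Z_m^2$ via $(i,k)\mapsto(i,-i-k,k)$. Then the return maps $F_c=f_c^m|_{P_0}$ satisfy \[F_0(i,k)=(i-2+\mathbf 1_{k=0},\ k+1),\quad F_1(i,k)=(i+\mathbf 1_{k=-1},\ k+1),\quad F_2(i,k)=(i+2-2\cdot\mathbf 1_{k=0},\ k-2).\] If moreover $m$ is odd, then with $\lambda=(-2)^{ -1}\in\mathbb Z_m$ and the affine bijections $\psi_0(i,k)=(k,\ i+2k)$, $\psi_1(i,k)=(k+1,\ i)$, $\psi_2(i,k)=(\lambda k,\ \lambda(i+k))$ of $\mathbb Z_m^2$, one has $\psi_c\circ F_c=O\circ\psi_c$ for $c=0,1,2$, where $O(u,v)=(u+1,\ v+\mathbf 1_{u=0})$.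
   Context: $V=(\mathbb Z_m)^3$ with points $v=(i,j,k)$, $S(v)=i+j+k\pmod m$; $\mathrm{bump}_i(i,j,k)=(i+1,j,k)$, $\mathrm{bump}_j(i,j,k)=(i,j+1,k)$, $\mathrm{bump}_k(i,j,k)=(i,j,k+1)$ mod $m$. The coloring is: $f_0(v)=\mathrm{bump}_j(v)$ if $S=0,k\ne0$; $\mathrm{bump}_k(v)$ if $S=1$; $\mathrm{bump}_i(v)$ otherwise. $f_1(v)=\mathrm{bump}_k(v)$ if $S=0$; $\mathrm{bump}_i(v)$ if $S=1,k=0$; $\mathrm{bump}_j(v)$ otherwise. $f_2(v)=\mathrm{bump}_j(v)$ if $S\in\{0,1\},k=0$; $\mathrm{bump}_i(v)$ if $S\in\{0,1\},k\ne0$; $\mathrm{bump}_k(v)$ otherwise. Here $\mathbf 1_{P}$ is $1$ if condition $P$ holds and $0$ otherwise. -}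

module Defs where

open import Data.Nat using (ℕ; NonZero; _∸_) renaming (_+_ to _+ℕ_; _*_ to _*ℕ_)
open import Data.Nat.DivMod using (_mod_)
open import Data.Fin using (Fin; toℕ)
open import Data.Fin.Properties using (_≟_)
open import Data.Product using (_×_; _,_)
open import Relation.Nullary using (yes; no)

module Zmod (m : ℕ) .{{_ : NonZero m}} where

  Zm : Set
  Zm = Fin m

  [_] : ℕ → Zm
  [ n ] = n mod m

  infixl 6 _⊕_ _⊖_
  infixl 7 _⊗_

  _⊕_ : Zm → Zm → Zm
  a ⊕ b = [ toℕ a +ℕ toℕ b ]

  _⊗_ : Zm → Zm → Zm
  a ⊗ b = [ toℕ a *ℕ toℕ b ]

  ⊝_ : Zm → Zm
  ⊝ a = [ m ∸ toℕ a ]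

  _⊖_ : Zm → Zm → Zm
  a ⊖ b = a ⊕ (⊝ b)

  𝟙≡ : Zm → Zm → Zm
  𝟙≡ a b with a ≟ b
  ... | yes _ = [ 1 ]
  ... | no _ = [ 0 ]

  V : Set
  V = Zm × Zm × Zm

  S : V → Zm
  S (i , j , k) = i ⊕ j ⊕ k

  bumpi bumpj bumpk : V → V
  bumpi (i , j , k) = (i ⊕ [ 1 ] , j , k)
  bumpj (i , j , k) = (i , j ⊕ [ 1 ] , k)
  bumpk (i , j , k) = (i , j , k ⊕ [ 1 ])

  f₀ : V → V
  f₀ v@(i , j , k) with S v ≟ [ 0 ] | k ≟ [ 0 ] | S v ≟ [ 1 ]
  ... | yes _ | no _  | _     = bumpj v
  ... | _     | _     | yes _ = bumpk v
  ... | _     | _     | no _  = bumpi v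

  f₁ : V → V
  f₁ v@(i , j , k) with S v ≟ [ 0 ] | S v ≟ [ 1 ] | k ≟ [ 0 ]
  ... | yes _ | _     | _     = bumpk v
  ... | no _  | yes _ | yes _ = bumpi v
  ... | no _  | _     | _     = bumpj v

  f₂ : V → V
  f₂ v@(i , j , k) with S v ≟ [ 0 ] | S v ≟ [ 1 ] | k ≟ [ 0 ]
  ... | yes _ | _     | yes _ = bumpj v
  ... | yes _ | _     | no _  = bumpi v
  ... | no _  | yes _ | yes _ = bumpj v
  ... | no _  | yes _ | no _  = bumpi v
  ... | no _  | no _  | _     = bumpk v

  iter : ℕ → (V → V) → V → V
  iter ℕ.zero f v = v
  iter (ℕ.suc n) f v = iter n f (f v)

  ι : Zm × Zm → V
  ι (i , k) = (i , ⊝ i ⊖ k , k)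

  F₀ F₁ F₂ : Zm × Zm → V
  F₀ p = iter m f₀ (ι p)
  F₁ p = iter m f₁ (ι p)
  F₂ p = iter m f₂ (ι p)

  O : Zm × Zm → Zm × Zm
  O (u , v) = (u ⊕ [ 1 ] , v ⊕ 𝟙≡ u [ 0 ])

  -- the affine maps ψ_c (ψ₂ depends on λ = (-2)⁻¹)
  ψ₀ ψ₁ : Zm × Zm → Zm × Zm
  ψ₀ (i , k) = (k , i ⊕ [ 2 ] ⊗ k)
  ψ₁ (i , k) = (k ⊕ [ 1 ] , i)

  ψ₂ : Zm → Zm × Zm → Zm × Zm
  ψ₂ λ' (i , k) = (λ' ⊗ k , λ' ⊗ (i ⊕ k))

  -- coordinates (i,k) of a point of P₀ (inverse of ι on P₀)
  π : V → Zm × Zm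
  π (i , j , k) = (i , k)

  F₀' F₁' F₂' : Zm × Zm → Zm × Zm
  F₀' p = π (F₀ p)
  F₁' p = π (F₁ p)
  F₂' p = π (F₂ p)

{-# OPTIONS --safe #-}
module Submission where

open import Defs
open import Algebra.Bundles using (CommutativeRing)
open import Algebra.Consequences.Propositional
  using (comm∧idˡ⇒id; comm∧invʳ⇒inv; comm∧distrˡ⇒distrʳ)
open import Algebra.Solver.Ring.AlmostCommutativeRing
  using (_-Raw-AlmostCommutative⟶_; Induced-equivalence; fromCommutativeRing)
open import Algebra.Structures using (IsCommutativeRing)
open import Data.Empty using (⊥-elim)
open import Data.Fin using (toℕ)
open import Data.Fin.Properties using (_≟_; toℕ-fromℕ<; toℕ-injective; toℕ<n)
open import Data.Integer as ℤ using (ℤ; +_; -[1+_])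
import Data.Integer.Properties as ℤ
open import Data.Maybe using (just; nothing)
open import Data.Nat as ℕ using (ℕ; NonZero; zero; suc; _∸_; _≤_; _<_; z<s; s<s; s≤s)
open import Data.Nat.Divisibility using (_∣_)
open import Data.Nat.DivMod using (_%_; m%n<n; m<n⇒m%n≡m; n%n≡0; %-distribˡ-+; %-distribˡ-*)
import Data.Nat.Properties as ℕ
open import Data.Product using (_×_; _,_)
open import Data.Sum using (_⊎_; inj₁; inj₂; [_,_]′)
open import Function using (_∘_; _⇔_; mk⇔; Equivalence)
open import Relation.Binary.Definitions using (WeaklyDecidable)
open import Relation.Binary.PropositionalEquality as ≡ using (_≡_; _≢_)
open import Relation.Nullary using (¬_; yes; no; contradiction)
open import Relation.Nullary.Decidable using (toSum)

-- Every f_c raises the level S by one, so the f_c-orbit of a point of P₀ runs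
-- through P₁, …, P_{m-1} and is back in P₀ after exactly m steps.  On the levels
-- 2, …, m-1 the maps f₀, f₁, f₂ are the single bumps bump_i, bump_j, bump_k, so
-- F_c is fixed by its first two steps, which only depend on whether k = 0
-- (k + 1 = 0 for f₁), followed by m - 2 ≡ -2 bumps of one coordinate.  The
-- conjugacies ψ_c ∘ F_c = O ∘ ψ_c are then affine identities in ℤ_m; for ψ₂ one
-- also uses that λ is a unit, so that λ k = 0 exactly when k = 0.

module IntegerCoefficients {c ℓ} (R : CommutativeRing c ℓ) where
  open CommutativeRing R
  open import Algebra.Properties.Ring ring using (-‿distribˡ-*; -‿distribʳ-*)
  open import Algebra.Properties.AbelianGroup +-abelianGroup
    using (ε⁻¹≈ε; ⁻¹-involutive; ⁻¹-∙-comm; ⁻¹-anti-homo‿-; //-rightDividesʳ)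
  open import Relation.Binary.Reasoning.Setoid setoid

  -- φ is a parameter, rather than n ↦ n × 1#, so that a solver constant con (+ n)
  -- denotes φ n itself; for ℤ_m this is [ n ] on the nose.
  module Fromℕ-homomorphism
    (φ : ℕ → Carrier)
    (φ-0 : φ 0 ≈ 0#) (φ-1 : φ 1 ≈ 1#)
    (φ-+ : ∀ a b → φ (a ℕ.+ b) ≈ φ a + φ b)
    (φ-* : ∀ a b → φ (a ℕ.* b) ≈ φ a * φ b)
    where

    fromℤ : ℤ → Carrier
    fromℤ (+ n)    = φ n
    fromℤ -[1+ n ] = - φ (suc n)

    -‿homo-+ : ∀ n → fromℤ (ℤ.- + n) ≈ - φ n
    -‿homo-+ zero    = trans φ-0 (sym (trans (-‿cong φ-0) ε⁻¹≈ε))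
    -‿homo-+ (suc n) = refl

    -‿homo : ∀ i → fromℤ (ℤ.- i) ≈ - fromℤ i
    -‿homo (+ n)    = -‿homo-+ n
    -‿homo -[1+ n ] = sym (⁻¹-involutive _)

    φ-∸ : ∀ {a b} → b ≤ a → φ (a ∸ b) ≈ φ a - φ b
    φ-∸ {a} {b} b≤a = begin
      φ (a ∸ b)               ≈⟨ //-rightDividesʳ (φ b) (φ (a ∸ b)) ⟨
      φ (a ∸ b) + φ b - φ b   ≈⟨ +-congʳ (φ-+ (a ∸ b) b) ⟨
      φ (a ∸ b ℕ.+ b) - φ b   ≡⟨ ≡.cong (λ n → φ n - φ b) (ℕ.m∸n+n≡m b≤a) ⟩
      φ a - φ b               ∎

    ⊖-homo : ∀ a b → fromℤ (a ℤ.⊖ b) ≈ φ a - φ b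
    ⊖-homo a b with ℕ.≤-total b a
    ... | inj₁ b≤a = begin
      fromℤ (a ℤ.⊖ b)         ≡⟨ ≡.cong fromℤ (ℤ.⊖-≥ b≤a) ⟩
      φ (a ∸ b)               ≈⟨ φ-∸ b≤a ⟩
      φ a - φ b               ∎
    ... | inj₂ a≤b = begin
      fromℤ (a ℤ.⊖ b)         ≡⟨ ≡.cong fromℤ (ℤ.⊖-≤ a≤b) ⟩
      fromℤ (ℤ.- + (b ∸ a))   ≈⟨ -‿homo-+ (b ∸ a) ⟩
      - φ (b ∸ a)             ≈⟨ -‿cong (φ-∸ a≤b) ⟩
      - (φ b - φ a)           ≈⟨ ⁻¹-anti-homo‿- (φ b) (φ a) ⟩
      φ a - φ b               ∎

    +-homo : ∀ i j → fromℤ (i ℤ.+ j) ≈ fromℤ i + fromℤ j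
    +-homo (+ a)    (+ b)    = φ-+ a b
    +-homo (+ a)    -[1+ b ] = ⊖-homo a (suc b)
    +-homo -[1+ a ] (+ b)    = trans (⊖-homo b (suc a)) (+-comm _ _)
    +-homo -[1+ a ] -[1+ b ] = begin
      - φ (suc (suc (a ℕ.+ b)))   ≡⟨ ≡.cong (λ n → - φ (suc n)) (ℕ.+-suc a b) ⟨
      - φ (suc a ℕ.+ suc b)       ≈⟨ -‿cong (φ-+ (suc a) (suc b)) ⟩
      - (φ (suc a) + φ (suc b))   ≈⟨ ⁻¹-∙-comm (φ (suc a)) (φ (suc b)) ⟨
      - φ (suc a) + - φ (suc b)   ∎

    *-homo⁺ : ∀ a j → fromℤ (+ a ℤ.* j) ≈ φ a * fromℤ j
    *-homo⁺ a (+ b)    = trans (reflexive (≡.cong fromℤ (≡.sym (ℤ.pos-* a b)))) (φ-* a b)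
    *-homo⁺ a -[1+ b ] = begin
      fromℤ (+ a ℤ.* ℤ.- + suc b)     ≡⟨ ≡.cong fromℤ (ℤ.neg-distribʳ-* (+ a) (+ suc b)) ⟨
      fromℤ (ℤ.- (+ a ℤ.* + suc b))   ≈⟨ -‿homo (+ a ℤ.* + suc b) ⟩
      - fromℤ (+ a ℤ.* + suc b)       ≈⟨ -‿cong (*-homo⁺ a (+ suc b)) ⟩
      - (φ a * φ (suc b))             ≈⟨ -‿distribʳ-* (φ a) (φ (suc b)) ⟩
      φ a * - φ (suc b)               ∎

    *-homo : ∀ i j → fromℤ (i ℤ.* j) ≈ fromℤ i * fromℤ j
    *-homo (+ a)    j = *-homo⁺ a j
    *-homo -[1+ a ] j = begin
      fromℤ (ℤ.- + suc a ℤ.* j)       ≡⟨ ≡.cong fromℤ (ℤ.neg-distribˡ-* (+ suc a) j) ⟨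
      fromℤ (ℤ.- (+ suc a ℤ.* j))     ≈⟨ -‿homo (+ suc a ℤ.* j) ⟩
      - fromℤ (+ suc a ℤ.* j)         ≈⟨ -‿cong (*-homo⁺ (suc a) j) ⟩
      - (φ (suc a) * fromℤ j)         ≈⟨ -‿distribˡ-* (φ (suc a)) (fromℤ j) ⟩
      - φ (suc a) * fromℤ j           ∎

    homomorphism : ℤ.+-*-rawRing -Raw-AlmostCommutative⟶ fromCommutativeRing R
    homomorphism = record
      { ⟦_⟧    = fromℤ
      ; +-homo = +-homo
      ; *-homo = *-homo
      ; -‿homo = -‿homo
      ; 0-homo = φ-0
      ; 1-homo = φ-1
      }

    fromℤ-≟ : WeaklyDecidable (Induced-equivalence homomorphism)
    fromℤ-≟ i j with i ℤ.≟ j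
    ... | yes ≡.refl = just refl
    ... | no _       = nothing

    open import Algebra.Solver.Ring ℤ.+-*-rawRing (fromCommutativeRing R) homomorphism fromℤ-≟ public

module ZmodRing (m : ℕ) .{{_ : NonZero m}} where
  open Zmod m
  open ≡ hiding ([_])
  open ≡-Reasoning

  toℕ-[] : ∀ a → toℕ [ a ] ≡ a % m
  toℕ-[] a = toℕ-fromℕ< (m%n<n a m)

  []-cong-% : ∀ {a b} → a % m ≡ b % m → [ a ] ≡ [ b ]
  []-cong-% {a} {b} a≡b = toℕ-injective (trans (toℕ-[] a) (trans a≡b (sym (toℕ-[] b))))

  []-injective : ∀ {a b} → a < m → b < m → [ a ] ≡ [ b ] → a ≡ b
  []-injective {a} {b} a<m b<m [a]≡[b] = begin
    a         ≡⟨ m<n⇒m%n≡m a<m ⟨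
    a % m     ≡⟨ toℕ-[] a ⟨
    toℕ [ a ] ≡⟨ cong toℕ [a]≡[b] ⟩
    toℕ [ b ] ≡⟨ toℕ-[] b ⟩
    b % m     ≡⟨ m<n⇒m%n≡m b<m ⟩
    b         ∎

  []-toℕ : ∀ x → [ toℕ x ] ≡ x
  []-toℕ x = toℕ-injective (trans (toℕ-[] (toℕ x)) (m<n⇒m%n≡m (toℕ<n x)))

  []-elim : {P : Zm → Set} → (∀ a → P [ a ]) → ∀ x → P x
  []-elim {P} P[] x = subst P ([]-toℕ x) (P[] (toℕ x))

  [m]≡[0] : [ m ] ≡ [ 0 ]
  [m]≡[0] = []-cong-% (trans (n%n≡0 m) (sym (m<n⇒m%n≡m (ℕ.>-nonZero⁻¹ m))))

  []-+ : ∀ a b → [ a ℕ.+ b ] ≡ [ a ] ⊕ [ b ]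
  []-+ a b = []-cong-% (begin
    (a ℕ.+ b) % m                   ≡⟨ %-distribˡ-+ a b m ⟩
    (a % m ℕ.+ b % m) % m           ≡⟨ cong₂ (λ x y → (x ℕ.+ y) % m) (toℕ-[] a) (toℕ-[] b) ⟨
    (toℕ [ a ] ℕ.+ toℕ [ b ]) % m   ∎)

  []-* : ∀ a b → [ a ℕ.* b ] ≡ [ a ] ⊗ [ b ]
  []-* a b = []-cong-% (begin
    (a ℕ.* b) % m                   ≡⟨ %-distribˡ-* a b m ⟩
    (a % m ℕ.* (b % m)) % m         ≡⟨ cong₂ (λ x y → (x ℕ.* y) % m) (toℕ-[] a) (toℕ-[] b) ⟨
    (toℕ [ a ] ℕ.* toℕ [ b ]) % m   ∎)

  ⊕-comm : ∀ x y → x ⊕ y ≡ y ⊕ x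
  ⊕-comm x y = cong [_] (ℕ.+-comm (toℕ x) (toℕ y))

  ⊗-comm : ∀ x y → x ⊗ y ≡ y ⊗ x
  ⊗-comm x y = cong [_] (ℕ.*-comm (toℕ x) (toℕ y))

  ⊕-assoc : ∀ x y z → x ⊕ y ⊕ z ≡ x ⊕ (y ⊕ z)
  ⊕-assoc = []-elim λ a → []-elim λ b → []-elim λ c → begin
    [ a ] ⊕ [ b ] ⊕ [ c ]      ≡⟨ cong (_⊕ [ c ]) ([]-+ a b) ⟨
    [ a ℕ.+ b ] ⊕ [ c ]        ≡⟨ []-+ (a ℕ.+ b) c ⟨
    [ a ℕ.+ b ℕ.+ c ]          ≡⟨ cong [_] (ℕ.+-assoc a b c) ⟩
    [ a ℕ.+ (b ℕ.+ c) ]        ≡⟨ []-+ a (b ℕ.+ c) ⟩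
    [ a ] ⊕ [ b ℕ.+ c ]        ≡⟨ cong ([ a ] ⊕_) ([]-+ b c) ⟩
    [ a ] ⊕ ([ b ] ⊕ [ c ])    ∎

  ⊗-assoc : ∀ x y z → x ⊗ y ⊗ z ≡ x ⊗ (y ⊗ z)
  ⊗-assoc = []-elim λ a → []-elim λ b → []-elim λ c → begin
    [ a ] ⊗ [ b ] ⊗ [ c ]      ≡⟨ cong (_⊗ [ c ]) ([]-* a b) ⟨
    [ a ℕ.* b ] ⊗ [ c ]        ≡⟨ []-* (a ℕ.* b) c ⟨
    [ a ℕ.* b ℕ.* c ]          ≡⟨ cong [_] (ℕ.*-assoc a b c) ⟩
    [ a ℕ.* (b ℕ.* c) ]        ≡⟨ []-* a (b ℕ.* c) ⟩
    [ a ] ⊗ [ b ℕ.* c ]        ≡⟨ cong ([ a ] ⊗_) ([]-* b c) ⟩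
    [ a ] ⊗ ([ b ] ⊗ [ c ])    ∎

  ⊗-distribˡ-⊕ : ∀ x y z → x ⊗ (y ⊕ z) ≡ x ⊗ y ⊕ x ⊗ z
  ⊗-distribˡ-⊕ = []-elim λ a → []-elim λ b → []-elim λ c → begin
    [ a ] ⊗ ([ b ] ⊕ [ c ])          ≡⟨ cong ([ a ] ⊗_) ([]-+ b c) ⟨
    [ a ] ⊗ [ b ℕ.+ c ]              ≡⟨ []-* a (b ℕ.+ c) ⟨
    [ a ℕ.* (b ℕ.+ c) ]              ≡⟨ cong [_] (ℕ.*-distribˡ-+ a b c) ⟩
    [ a ℕ.* b ℕ.+ a ℕ.* c ]          ≡⟨ []-+ (a ℕ.* b) (a ℕ.* c) ⟩
    [ a ℕ.* b ] ⊕ [ a ℕ.* c ]        ≡⟨ cong₂ _⊕_ ([]-* a b) ([]-* a c) ⟩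
    [ a ] ⊗ [ b ] ⊕ [ a ] ⊗ [ c ]    ∎

  ⊕-identityˡ : ∀ x → [ 0 ] ⊕ x ≡ x
  ⊕-identityˡ = []-elim λ a → sym ([]-+ 0 a)

  ⊗-identityˡ : ∀ x → [ 1 ] ⊗ x ≡ x
  ⊗-identityˡ = []-elim λ a → trans (sym ([]-* 1 a)) (cong [_] (ℕ.*-identityˡ a))

  ⊕-inverseʳ : ∀ x → x ⊕ ⊝ x ≡ [ 0 ]
  ⊕-inverseʳ x = begin
    x ⊕ ⊝ x                        ≡⟨ cong (_⊕ ⊝ x) ([]-toℕ x) ⟨
    [ toℕ x ] ⊕ [ m ∸ toℕ x ]      ≡⟨ []-+ (toℕ x) (m ∸ toℕ x) ⟨
    [ toℕ x ℕ.+ (m ∸ toℕ x) ]      ≡⟨ cong [_] (ℕ.m+[n∸m]≡n (ℕ.<⇒≤ (toℕ<n x))) ⟩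
    [ m ]                          ≡⟨ [m]≡[0] ⟩
    [ 0 ]                          ∎

  isCommutativeRing : IsCommutativeRing _≡_ _⊕_ _⊗_ ⊝_ [ 0 ] [ 1 ]
  isCommutativeRing = record
    { isRing = record
      { +-isAbelianGroup = record
        { isGroup = record
          { isMonoid = record
            { isSemigroup = record
              { isMagma = record { isEquivalence = isEquivalence ; ∙-cong = cong₂ _⊕_ }
              ; assoc = ⊕-assoc }
            ; identity = comm∧idˡ⇒id ⊕-comm ⊕-identityˡ }
          ; inverse = comm∧invʳ⇒inv ⊕-comm ⊕-inverseʳ
          ; ⁻¹-cong = cong ⊝_ }
        ; comm = ⊕-comm }
      ; *-cong = cong₂ _⊗_
      ; *-assoc = ⊗-assoc
      ; *-identity = comm∧idˡ⇒id ⊗-comm ⊗-identityˡ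
      ; distrib = ⊗-distribˡ-⊕ , comm∧distrˡ⇒distrʳ ⊗-comm ⊗-distribˡ-⊕ }
    ; *-comm = ⊗-comm }

  commutativeRing : CommutativeRing _ _
  commutativeRing = record { isCommutativeRing = isCommutativeRing }

  open IntegerCoefficients.Fromℕ-homomorphism commutativeRing [_] refl refl []-+ []-* public

module ReturnMaps (r : ℕ) where
  -- With m = 2 + r, iter m f v unfolds to iter r f (f (f v)).
  m : ℕ
  m = suc (suc r)

  open Zmod m
  open ZmodRing m
  open CommutativeRing commutativeRing using (+-identityʳ; +-assoc; -‿inverseˡ; *-identityˡ; zeroʳ)
  open import Algebra.Properties.Group (CommutativeRing.+-group commutativeRing) using (inverseˡ-unique)
  open ≡ hiding ([_])
  open ≡-Reasoning

  coordₖ : V → Zm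
  coordₖ (_ , _ , k) = k

  [0]≢[1] : [ 0 ] ≢ [ 1 ]
  [0]≢[1] e = ℕ.0≢1+n ([]-injective z<s (s<s z<s) e)

  [r]≡-[2] : [ r ] ≡ ⊝ [ 2 ]
  [r]≡-[2] = inverseˡ-unique [ r ] [ 2 ] (begin
    [ r ] ⊕ [ 2 ]   ≡⟨ []-+ r 2 ⟨
    [ r ℕ.+ 2 ]     ≡⟨ cong [_] (ℕ.+-comm r 2) ⟩
    [ m ]           ≡⟨ [m]≡[0] ⟩
    [ 0 ]           ∎)

  ⊕[1]⊕[t]≡⊕[1+t] : ∀ x t → x ⊕ [ 1 ] ⊕ [ t ] ≡ x ⊕ [ suc t ]
  ⊕[1]⊕[t]≡⊕[1+t] x t = trans (+-assoc x [ 1 ] [ t ]) (cong (x ⊕_) (sym ([]-+ 1 t)))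

  record Raises (f : V → V) : Set where
    field S-suc : ∀ v → S (f v) ≡ S v ⊕ [ 1 ]
  open Raises

  bumpi-raises : Raises bumpi
  bumpi-raises .S-suc (i , j , k) = solve 3 (λ i j k → i :+ con (+ 1) :+ j :+ k := i :+ j :+ k :+ con (+ 1)) refl i j k

  bumpj-raises : Raises bumpj
  bumpj-raises .S-suc (i , j , k) = solve 3 (λ i j k → i :+ (j :+ con (+ 1)) :+ k := i :+ j :+ k :+ con (+ 1)) refl i j k

  bumpk-raises : Raises bumpk
  bumpk-raises .S-suc (i , j , k) = solve 3 (λ i j k → i :+ j :+ (k :+ con (+ 1)) := i :+ j :+ k :+ con (+ 1)) refl i j k

  S-iter : ∀ {f} → Raises f → ∀ t v → S (iter t f v) ≡ S v ⊕ [ t ]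
  S-iter f↑ zero    v = sym (+-identityʳ (S v))
  S-iter {f} f↑ (suc t) v = begin
    S (iter t f (f v))    ≡⟨ S-iter f↑ t (f v) ⟩
    S (f v) ⊕ [ t ]       ≡⟨ cong (_⊕ [ t ]) (f↑ .S-suc v) ⟩
    S v ⊕ [ 1 ] ⊕ [ t ]   ≡⟨ ⊕[1]⊕[t]≡⊕[1+t] (S v) t ⟩
    S v ⊕ [ suc t ]       ∎

  S-iter-from : ∀ {f} → Raises f → ∀ a t v → S v ≡ [ a ] → S (iter t f v) ≡ [ a ℕ.+ t ]
  S-iter-from {f} f↑ a t v v∈Pₐ = begin
    S (iter t f v)   ≡⟨ S-iter f↑ t v ⟩
    S v ⊕ [ t ]      ≡⟨ cong (_⊕ [ t ]) v∈Pₐ ⟩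
    [ a ] ⊕ [ t ]    ≡⟨ []-+ a t ⟨
    [ a ℕ.+ t ]      ∎

  iter-bumpi : ∀ t i j k → iter t bumpi (i , j , k) ≡ (i ⊕ [ t ] , j , k)
  iter-bumpi zero    i j k = cong (_, j , k) (sym (+-identityʳ i))
  iter-bumpi (suc t) i j k = trans (iter-bumpi t (i ⊕ [ 1 ]) j k) (cong (_, j , k) (⊕[1]⊕[t]≡⊕[1+t] i t))

  iter-bumpj : ∀ t i j k → iter t bumpj (i , j , k) ≡ (i , j ⊕ [ t ] , k)
  iter-bumpj zero    i j k = cong (λ x → i , x , k) (sym (+-identityʳ j))
  iter-bumpj (suc t) i j k = trans (iter-bumpj t i (j ⊕ [ 1 ]) k) (cong (λ x → i , x , k) (⊕[1]⊕[t]≡⊕[1+t] j t))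

  iter-bumpk : ∀ t i j k → iter t bumpk (i , j , k) ≡ (i , j , k ⊕ [ t ])
  iter-bumpk zero    i j k = cong (λ x → i , j , x) (sym (+-identityʳ k))
  iter-bumpk (suc t) i j k = trans (iter-bumpk t i j (k ⊕ [ 1 ])) (cong (λ x → i , j , x) (⊕[1]⊕[t]≡⊕[1+t] k t))

  iter-cong-orbit : ∀ (f g : V → V) t v → (∀ s → s < t → f (iter s g v) ≡ g (iter s g v)) →
                    iter t f v ≡ iter t g v
  iter-cong-orbit f g zero    v f≡g = refl
  iter-cong-orbit f g (suc t) v f≡g = begin
    iter t f (f v)   ≡⟨ cong (iter t f) (f≡g 0 z<s) ⟩
    iter t f (g v)   ≡⟨ iter-cong-orbit f g t (g v) (λ s s<t → f≡g (suc s) (s<s s<t)) ⟩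
    iter t g (g v)   ∎

  AgreeOutside₀₁ : (V → V) → (V → V) → Set
  AgreeOutside₀₁ f g = ∀ v → S v ≢ [ 0 ] → S v ≢ [ 1 ] → f v ≡ g v

  [2+s]≢[0] : ∀ {s} → 2 ℕ.+ s < m → [ 2 ℕ.+ s ] ≢ [ 0 ]
  [2+s]≢[0] 2+s<m e = ℕ.1+n≢0 ([]-injective 2+s<m z<s e)

  [2+s]≢[1] : ∀ {s} → 2 ℕ.+ s < m → [ 2 ℕ.+ s ] ≢ [ 1 ]
  [2+s]≢[1] 2+s<m e = ℕ.1+n≢0 (ℕ.suc-injective ([]-injective 2+s<m (s<s z<s) e))

  iter-from-P₂ : ∀ {f g} → Raises g → AgreeOutside₀₁ f g → ∀ v → S v ≡ [ 2 ] → iter r f v ≡ iter r g v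
  iter-from-P₂ {f} {g} g↑ f≡g v v∈P₂ = iter-cong-orbit f g r v agree
    where
    agree : ∀ s → s < r → f (iter s g v) ≡ g (iter s g v)
    agree s s<r = f≡g (iter s g v) ([2+s]≢[0] 2+s<m ∘ trans (sym gˢv∈P₂₊ₛ)) ([2+s]≢[1] 2+s<m ∘ trans (sym gˢv∈P₂₊ₛ))
      where
      gˢv∈P₂₊ₛ : S (iter s g v) ≡ [ 2 ℕ.+ s ]
      gˢv∈P₂₊ₛ = S-iter-from g↑ 2 s v v∈P₂
      2+s<m : 2 ℕ.+ s < m
      2+s<m = s<s (s<s s<r)

  iter-from-P₀ : ∀ {f g} → Raises f → Raises g → AgreeOutside₀₁ f g →
                 ∀ v → S v ≡ [ 0 ] → iter m f v ≡ iter r g (f (f v))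
  iter-from-P₀ {f} f↑ g↑ f≡g v v∈P₀ = iter-from-P₂ g↑ f≡g (f (f v)) (S-iter-from f↑ 0 2 v v∈P₀)

  S-ι : ∀ p → S (ι p) ≡ [ 0 ]
  S-ι (i , k) = solve 2 (λ i k → i :+ (:- i :- k) :+ k := con (+ 0)) refl i k

  ι-π : ∀ v → S v ≡ [ 0 ] → ι (π v) ≡ v
  ι-π (i , j , k) v∈P₀ = cong (λ x → i , x , k) (begin
    ⊝ i ⊖ k                ≡⟨ solve 2 (λ i k → :- i :- k := con (+ 0) :- i :- k) refl i k ⟩
    [ 0 ] ⊖ i ⊖ k          ≡⟨ cong (λ s → s ⊖ i ⊖ k) v∈P₀ ⟨
    i ⊕ j ⊕ k ⊖ i ⊖ k      ≡⟨ solve 3 (λ i j k → i :+ j :+ k :- i :- k := j) refl i j k ⟩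
    j                      ∎)

  returns-to-P₀ : ∀ {f} → Raises f → ∀ p → iter m f (ι p) ≡ ι (π (iter m f (ι p)))
  returns-to-P₀ f↑ p = sym (ι-π _ (trans (S-iter-from f↑ 0 m (ι p) (S-ι p)) [m]≡[0]))

  f₀-raises : Raises f₀
  f₀-raises .S-suc v@(i , j , k) with S v ≟ [ 0 ] | k ≟ [ 0 ] | S v ≟ [ 1 ]
  ... | yes _ | no _  | _     = bumpj-raises .S-suc v
  ... | yes _ | yes _ | yes _ = bumpk-raises .S-suc v
  ... | yes _ | yes _ | no _  = bumpi-raises .S-suc v
  ... | no _  | _     | yes _ = bumpk-raises .S-suc v
  ... | no _  | _     | no _  = bumpi-raises .S-suc v

  f₀-outside₀₁ : AgreeOutside₀₁ f₀ bumpi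
  f₀-outside₀₁ v@(i , j , k) v∉P₀ v∉P₁ with S v ≟ [ 0 ] | k ≟ [ 0 ] | S v ≟ [ 1 ]
  ... | yes v∈P₀ | _ | _       = contradiction v∈P₀ v∉P₀
  ... | no _     | _ | yes v∈P₁ = contradiction v∈P₁ v∉P₁
  ... | no _     | _ | no _     = refl

  f₀-P₀-k≡0 : ∀ v → S v ≡ [ 0 ] → coordₖ v ≡ [ 0 ] → f₀ v ≡ bumpi v
  f₀-P₀-k≡0 v@(i , j , k) v∈P₀ k≡0 with S v ≟ [ 0 ] | k ≟ [ 0 ] | S v ≟ [ 1 ]
  ... | no v∉P₀ | _      | _        = contradiction v∈P₀ v∉P₀
  ... | yes _   | no k≢0 | _        = contradiction k≡0 k≢0
  ... | yes _   | yes _  | yes v∈P₁ = contradiction (trans (sym v∈P₀) v∈P₁) [0]≢[1]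
  ... | yes _   | yes _  | no _     = refl

  f₀-P₀-k≢0 : ∀ v → S v ≡ [ 0 ] → coordₖ v ≢ [ 0 ] → f₀ v ≡ bumpj v
  f₀-P₀-k≢0 v@(i , j , k) v∈P₀ k≢0 with S v ≟ [ 0 ] | k ≟ [ 0 ] | S v ≟ [ 1 ]
  ... | yes _   | no _     | _ = refl
  ... | yes _   | yes k≡0  | _ = contradiction k≡0 k≢0
  ... | no v∉P₀ | _        | _ = contradiction v∈P₀ v∉P₀

  f₀-P₁ : ∀ v → S v ≡ [ 1 ] → f₀ v ≡ bumpk v
  f₀-P₁ v@(i , j , k) v∈P₁ with S v ≟ [ 0 ] | k ≟ [ 0 ] | S v ≟ [ 1 ]
  ... | yes v∈P₀ | _     | _       = contradiction (trans (sym v∈P₀) v∈P₁) [0]≢[1]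
  ... | no _     | _     | yes _   = refl
  ... | no _     | _     | no v∉P₁ = contradiction v∈P₁ v∉P₁

  f₁-raises : Raises f₁
  f₁-raises .S-suc v@(i , j , k) with S v ≟ [ 0 ] | S v ≟ [ 1 ] | k ≟ [ 0 ]
  ... | yes _ | _     | _     = bumpk-raises .S-suc v
  ... | no _  | yes _ | yes _ = bumpi-raises .S-suc v
  ... | no _  | yes _ | no _  = bumpj-raises .S-suc v
  ... | no _  | no _  | _     = bumpj-raises .S-suc v

  f₁-outside₀₁ : AgreeOutside₀₁ f₁ bumpj
  f₁-outside₀₁ v@(i , j , k) v∉P₀ v∉P₁ with S v ≟ [ 0 ] | S v ≟ [ 1 ] | k ≟ [ 0 ]
  ... | yes v∈P₀ | _        | _ = contradiction v∈P₀ v∉P₀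
  ... | no _     | yes v∈P₁ | _ = contradiction v∈P₁ v∉P₁
  ... | no _     | no _     | _ = refl

  f₁-P₀ : ∀ v → S v ≡ [ 0 ] → f₁ v ≡ bumpk v
  f₁-P₀ v@(i , j , k) v∈P₀ with S v ≟ [ 0 ] | S v ≟ [ 1 ] | k ≟ [ 0 ]
  ... | yes _   | _ | _ = refl
  ... | no v∉P₀ | _ | _ = contradiction v∈P₀ v∉P₀

  f₁-P₁-k≡0 : ∀ v → S v ≡ [ 1 ] → coordₖ v ≡ [ 0 ] → f₁ v ≡ bumpi v
  f₁-P₁-k≡0 v@(i , j , k) v∈P₁ k≡0 with S v ≟ [ 0 ] | S v ≟ [ 1 ] | k ≟ [ 0 ]
  ... | yes v∈P₀ | _       | _      = contradiction (trans (sym v∈P₀) v∈P₁) [0]≢[1]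
  ... | no _     | yes _   | yes _  = refl
  ... | no _     | yes _   | no k≢0 = contradiction k≡0 k≢0
  ... | no _     | no v∉P₁ | _      = contradiction v∈P₁ v∉P₁

  f₁-P₁-k≢0 : ∀ v → S v ≡ [ 1 ] → coordₖ v ≢ [ 0 ] → f₁ v ≡ bumpj v
  f₁-P₁-k≢0 v@(i , j , k) v∈P₁ k≢0 with S v ≟ [ 0 ] | S v ≟ [ 1 ] | k ≟ [ 0 ]
  ... | yes v∈P₀ | _     | _       = contradiction (trans (sym v∈P₀) v∈P₁) [0]≢[1]
  ... | no _     | yes _ | yes k≡0 = contradiction k≡0 k≢0
  ... | no _     | yes _ | no _    = refl
  ... | no _     | no _  | _       = refl

  f₂-raises : Raises f₂
  f₂-raises .S-suc v@(i , j , k) with S v ≟ [ 0 ] | S v ≟ [ 1 ] | k ≟ [ 0 ]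
  ... | yes _ | _     | yes _ = bumpj-raises .S-suc v
  ... | yes _ | _     | no _  = bumpi-raises .S-suc v
  ... | no _  | yes _ | yes _ = bumpj-raises .S-suc v
  ... | no _  | yes _ | no _  = bumpi-raises .S-suc v
  ... | no _  | no _  | _     = bumpk-raises .S-suc v

  f₂-outside₀₁ : AgreeOutside₀₁ f₂ bumpk
  f₂-outside₀₁ v@(i , j , k) v∉P₀ v∉P₁ with S v ≟ [ 0 ] | S v ≟ [ 1 ] | k ≟ [ 0 ]
  ... | yes v∈P₀ | _        | _ = contradiction v∈P₀ v∉P₀
  ... | no _     | yes v∈P₁ | _ = contradiction v∈P₁ v∉P₁
  ... | no _     | no _     | _ = refl

  f₂-P₀₁-k≡0 : ∀ v → S v ≡ [ 0 ] ⊎ S v ≡ [ 1 ] → coordₖ v ≡ [ 0 ] → f₂ v ≡ bumpj v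
  f₂-P₀₁-k≡0 v@(i , j , k) v∈P₀₁ k≡0 with S v ≟ [ 0 ] | S v ≟ [ 1 ] | k ≟ [ 0 ]
  ... | _       | _       | no k≢0 = contradiction k≡0 k≢0
  ... | yes _   | _       | yes _  = refl
  ... | no _    | yes _   | yes _  = refl
  ... | no v∉P₀ | no v∉P₁ | yes _  = ⊥-elim ([ v∉P₀ , v∉P₁ ]′ v∈P₀₁)

  f₂-P₀₁-k≢0 : ∀ v → S v ≡ [ 0 ] ⊎ S v ≡ [ 1 ] → coordₖ v ≢ [ 0 ] → f₂ v ≡ bumpi v
  f₂-P₀₁-k≢0 v@(i , j , k) v∈P₀₁ k≢0 with S v ≟ [ 0 ] | S v ≟ [ 1 ] | k ≟ [ 0 ]
  ... | _       | _       | yes k≡0 = contradiction k≡0 k≢0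
  ... | yes _   | _       | no _    = refl
  ... | no _    | yes _   | no _    = refl
  ... | no v∉P₀ | no v∉P₁ | no _    = ⊥-elim ([ v∉P₀ , v∉P₁ ]′ v∈P₀₁)

  𝟙≡-≡ : ∀ {a b} → a ≡ b → 𝟙≡ a b ≡ [ 1 ]
  𝟙≡-≡ {a} {b} a≡b with a ≟ b
  ... | yes _   = refl
  ... | no a≢b  = contradiction a≡b a≢b

  𝟙≡-≢ : ∀ {a b} → a ≢ b → 𝟙≡ a b ≡ [ 0 ]
  𝟙≡-≢ {a} {b} a≢b with a ≟ b
  ... | yes a≡b = contradiction a≡b a≢b
  ... | no _    = refl

  𝟙≡-cong : ∀ {a b c d} → a ≡ b ⇔ c ≡ d → 𝟙≡ a b ≡ 𝟙≡ c d
  𝟙≡-cong {a} {b} a≡b⇔c≡d with a ≟ b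
  ... | yes a≡b = sym (𝟙≡-≡ (Equivalence.to a≡b⇔c≡d a≡b))
  ... | no a≢b  = sym (𝟙≡-≢ (a≢b ∘ Equivalence.from a≡b⇔c≡d))

  ≡-[1]⇔⊕[1]≡[0] : ∀ {k} → k ≡ ⊝ [ 1 ] ⇔ k ⊕ [ 1 ] ≡ [ 0 ]
  ≡-[1]⇔⊕[1]≡[0] {k} = mk⇔ (λ { refl → -‿inverseˡ [ 1 ] }) (inverseˡ-unique k [ 1 ])

  ≡[0]⇔unit⊗≡[0] : ∀ a b → a ⊗ b ≡ [ 1 ] → ∀ x → x ≡ [ 0 ] ⇔ a ⊗ x ≡ [ 0 ]
  ≡[0]⇔unit⊗≡[0] a b ab≡1 x = mk⇔ (λ { refl → zeroʳ a }) λ ax≡0 → begin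
    x                ≡⟨ *-identityˡ x ⟨
    [ 1 ] ⊗ x        ≡⟨ cong (_⊗ x) ab≡1 ⟨
    a ⊗ b ⊗ x        ≡⟨ solve 3 (λ a b x → a :* b :* x := b :* (a :* x)) refl a b x ⟩
    b ⊗ (a ⊗ x)      ≡⟨ cong (b ⊗_) ax≡0 ⟩
    b ⊗ [ 0 ]        ≡⟨ zeroʳ b ⟩
    [ 0 ]            ∎

  F₀'-k≡0 : ∀ i k → k ≡ [ 0 ] → F₀' (i , k) ≡ (i ⊖ [ 2 ] ⊕ 𝟙≡ k [ 0 ] , k ⊕ [ 1 ])
  F₀'-k≡0 i k k≡0 = begin
    F₀' (i , k)                            ≡⟨ cong π (iter-from-P₀ f₀-raises bumpi-raises f₀-outside₀₁ v v∈P₀) ⟩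
    π (iter r bumpi (f₀ (f₀ v)))           ≡⟨ cong (π ∘ iter r bumpi) first-steps ⟩
    π (iter r bumpi (bumpk (bumpi v)))     ≡⟨ cong π (iter-bumpi r _ _ _) ⟩
    (i ⊕ [ 1 ] ⊕ [ r ] , k ⊕ [ 1 ])        ≡⟨ cong (λ x → i ⊕ [ 1 ] ⊕ x , k ⊕ [ 1 ]) [r]≡-[2] ⟩
    (i ⊕ [ 1 ] ⊖ [ 2 ] , k ⊕ [ 1 ])        ≡⟨ cong (_, k ⊕ [ 1 ]) (solve 1 (λ i → i :+ con (+ 1) :- con (+ 2) := i :- con (+ 2) :+ con (+ 1)) refl i) ⟩
    (i ⊖ [ 2 ] ⊕ [ 1 ] , k ⊕ [ 1 ])        ≡⟨ cong (λ e → i ⊖ [ 2 ] ⊕ e , k ⊕ [ 1 ]) (𝟙≡-≡ k≡0) ⟨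
    (i ⊖ [ 2 ] ⊕ 𝟙≡ k [ 0 ] , k ⊕ [ 1 ])   ∎
    where
    v : V
    v = ι (i , k)
    v∈P₀ : S v ≡ [ 0 ]
    v∈P₀ = S-ι (i , k)
    first-steps : f₀ (f₀ v) ≡ bumpk (bumpi v)
    first-steps = trans (cong f₀ (f₀-P₀-k≡0 v v∈P₀ k≡0)) (f₀-P₁ (bumpi v) (S-iter-from bumpi-raises 0 1 v v∈P₀))

  F₀'-k≢0 : ∀ i k → k ≢ [ 0 ] → F₀' (i , k) ≡ (i ⊖ [ 2 ] ⊕ 𝟙≡ k [ 0 ] , k ⊕ [ 1 ])
  F₀'-k≢0 i k k≢0 = begin
    F₀' (i , k)                            ≡⟨ cong π (iter-from-P₀ f₀-raises bumpi-raises f₀-outside₀₁ v v∈P₀) ⟩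
    π (iter r bumpi (f₀ (f₀ v)))           ≡⟨ cong (π ∘ iter r bumpi) first-steps ⟩
    π (iter r bumpi (bumpk (bumpj v)))     ≡⟨ cong π (iter-bumpi r _ _ _) ⟩
    (i ⊕ [ r ] , k ⊕ [ 1 ])                ≡⟨ cong (λ x → i ⊕ x , k ⊕ [ 1 ]) [r]≡-[2] ⟩
    (i ⊖ [ 2 ] , k ⊕ [ 1 ])                ≡⟨ cong (_, k ⊕ [ 1 ]) (+-identityʳ (i ⊖ [ 2 ])) ⟨
    (i ⊖ [ 2 ] ⊕ [ 0 ] , k ⊕ [ 1 ])        ≡⟨ cong (λ e → i ⊖ [ 2 ] ⊕ e , k ⊕ [ 1 ]) (𝟙≡-≢ k≢0) ⟨
    (i ⊖ [ 2 ] ⊕ 𝟙≡ k [ 0 ] , k ⊕ [ 1 ])   ∎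
    where
    v : V
    v = ι (i , k)
    v∈P₀ : S v ≡ [ 0 ]
    v∈P₀ = S-ι (i , k)
    first-steps : f₀ (f₀ v) ≡ bumpk (bumpj v)
    first-steps = trans (cong f₀ (f₀-P₀-k≢0 v v∈P₀ k≢0)) (f₀-P₁ (bumpj v) (S-iter-from bumpj-raises 0 1 v v∈P₀))

  F₀'-formula : ∀ i k → F₀' (i , k) ≡ (i ⊖ [ 2 ] ⊕ 𝟙≡ k [ 0 ] , k ⊕ [ 1 ])
  F₀'-formula i k = [ F₀'-k≡0 i k , F₀'-k≢0 i k ]′ (toSum (k ≟ [ 0 ]))

  F₁'-k≡-1 : ∀ i k → k ≡ ⊝ [ 1 ] → F₁' (i , k) ≡ (i ⊕ 𝟙≡ k (⊝ [ 1 ]) , k ⊕ [ 1 ])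
  F₁'-k≡-1 i k k≡-1 = begin
    F₁' (i , k)                            ≡⟨ cong π (iter-from-P₀ f₁-raises bumpj-raises f₁-outside₀₁ v v∈P₀) ⟩
    π (iter r bumpj (f₁ (f₁ v)))           ≡⟨ cong (π ∘ iter r bumpj) first-steps ⟩
    π (iter r bumpj (bumpi (bumpk v)))     ≡⟨ cong π (iter-bumpj r _ _ _) ⟩
    (i ⊕ [ 1 ] , k ⊕ [ 1 ])                ≡⟨ cong (λ e → i ⊕ e , k ⊕ [ 1 ]) (𝟙≡-≡ k≡-1) ⟨
    (i ⊕ 𝟙≡ k (⊝ [ 1 ]) , k ⊕ [ 1 ])       ∎
    where
    v : V
    v = ι (i , k)
    v∈P₀ : S v ≡ [ 0 ]
    v∈P₀ = S-ι (i , k)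
    first-steps : f₁ (f₁ v) ≡ bumpi (bumpk v)
    first-steps = trans (cong f₁ (f₁-P₀ v v∈P₀))
      (f₁-P₁-k≡0 (bumpk v) (S-iter-from bumpk-raises 0 1 v v∈P₀) (Equivalence.to ≡-[1]⇔⊕[1]≡[0] k≡-1))

  F₁'-k≢-1 : ∀ i k → k ≢ ⊝ [ 1 ] → F₁' (i , k) ≡ (i ⊕ 𝟙≡ k (⊝ [ 1 ]) , k ⊕ [ 1 ])
  F₁'-k≢-1 i k k≢-1 = begin
    F₁' (i , k)                            ≡⟨ cong π (iter-from-P₀ f₁-raises bumpj-raises f₁-outside₀₁ v v∈P₀) ⟩
    π (iter r bumpj (f₁ (f₁ v)))           ≡⟨ cong (π ∘ iter r bumpj) first-steps ⟩
    π (iter r bumpj (bumpj (bumpk v)))     ≡⟨ cong π (iter-bumpj r _ _ _) ⟩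
    (i , k ⊕ [ 1 ])                        ≡⟨ cong (_, k ⊕ [ 1 ]) (+-identityʳ i) ⟨
    (i ⊕ [ 0 ] , k ⊕ [ 1 ])                ≡⟨ cong (λ e → i ⊕ e , k ⊕ [ 1 ]) (𝟙≡-≢ k≢-1) ⟨
    (i ⊕ 𝟙≡ k (⊝ [ 1 ]) , k ⊕ [ 1 ])       ∎
    where
    v : V
    v = ι (i , k)
    v∈P₀ : S v ≡ [ 0 ]
    v∈P₀ = S-ι (i , k)
    first-steps : f₁ (f₁ v) ≡ bumpj (bumpk v)
    first-steps = trans (cong f₁ (f₁-P₀ v v∈P₀))
      (f₁-P₁-k≢0 (bumpk v) (S-iter-from bumpk-raises 0 1 v v∈P₀) (k≢-1 ∘ Equivalence.from ≡-[1]⇔⊕[1]≡[0]))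

  F₁'-formula : ∀ i k → F₁' (i , k) ≡ (i ⊕ 𝟙≡ k (⊝ [ 1 ]) , k ⊕ [ 1 ])
  F₁'-formula i k = [ F₁'-k≡-1 i k , F₁'-k≢-1 i k ]′ (toSum (k ≟ ⊝ [ 1 ]))

  F₂'-k≡0 : ∀ i k → k ≡ [ 0 ] → F₂' (i , k) ≡ (i ⊕ [ 2 ] ⊖ [ 2 ] ⊗ 𝟙≡ k [ 0 ] , k ⊖ [ 2 ])
  F₂'-k≡0 i k k≡0 = begin
    F₂' (i , k)                                   ≡⟨ cong π (iter-from-P₀ f₂-raises bumpk-raises f₂-outside₀₁ v v∈P₀) ⟩
    π (iter r bumpk (f₂ (f₂ v)))                  ≡⟨ cong (π ∘ iter r bumpk) first-steps ⟩
    π (iter r bumpk (bumpj (bumpj v)))            ≡⟨ cong π (iter-bumpk r _ _ _) ⟩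
    (i , k ⊕ [ r ])                               ≡⟨ cong (λ x → i , k ⊕ x) [r]≡-[2] ⟩
    (i , k ⊖ [ 2 ])                               ≡⟨ cong (_, k ⊖ [ 2 ]) (solve 1 (λ i → i := i :+ con (+ 2) :- con (+ 2) :* con (+ 1)) refl i) ⟩
    (i ⊕ [ 2 ] ⊖ [ 2 ] ⊗ [ 1 ] , k ⊖ [ 2 ])       ≡⟨ cong (λ e → i ⊕ [ 2 ] ⊖ [ 2 ] ⊗ e , k ⊖ [ 2 ]) (𝟙≡-≡ k≡0) ⟨
    (i ⊕ [ 2 ] ⊖ [ 2 ] ⊗ 𝟙≡ k [ 0 ] , k ⊖ [ 2 ])  ∎
    where
    v : V
    v = ι (i , k)
    v∈P₀ : S v ≡ [ 0 ]
    v∈P₀ = S-ι (i , k)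
    first-steps : f₂ (f₂ v) ≡ bumpj (bumpj v)
    first-steps = trans (cong f₂ (f₂-P₀₁-k≡0 v (inj₁ v∈P₀) k≡0))
      (f₂-P₀₁-k≡0 (bumpj v) (inj₂ (S-iter-from bumpj-raises 0 1 v v∈P₀)) k≡0)

  F₂'-k≢0 : ∀ i k → k ≢ [ 0 ] → F₂' (i , k) ≡ (i ⊕ [ 2 ] ⊖ [ 2 ] ⊗ 𝟙≡ k [ 0 ] , k ⊖ [ 2 ])
  F₂'-k≢0 i k k≢0 = begin
    F₂' (i , k)                                   ≡⟨ cong π (iter-from-P₀ f₂-raises bumpk-raises f₂-outside₀₁ v v∈P₀) ⟩
    π (iter r bumpk (f₂ (f₂ v)))                  ≡⟨ cong (π ∘ iter r bumpk) first-steps ⟩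
    π (iter r bumpk (bumpi (bumpi v)))            ≡⟨ cong π (iter-bumpk r _ _ _) ⟩
    (i ⊕ [ 1 ] ⊕ [ 1 ] , k ⊕ [ r ])               ≡⟨ cong (λ x → i ⊕ [ 1 ] ⊕ [ 1 ] , k ⊕ x) [r]≡-[2] ⟩
    (i ⊕ [ 1 ] ⊕ [ 1 ] , k ⊖ [ 2 ])               ≡⟨ cong (_, k ⊖ [ 2 ]) (solve 1 (λ i → i :+ con (+ 1) :+ con (+ 1) := i :+ con (+ 2) :- con (+ 2) :* con (+ 0)) refl i) ⟩
    (i ⊕ [ 2 ] ⊖ [ 2 ] ⊗ [ 0 ] , k ⊖ [ 2 ])       ≡⟨ cong (λ e → i ⊕ [ 2 ] ⊖ [ 2 ] ⊗ e , k ⊖ [ 2 ]) (𝟙≡-≢ k≢0) ⟨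
    (i ⊕ [ 2 ] ⊖ [ 2 ] ⊗ 𝟙≡ k [ 0 ] , k ⊖ [ 2 ])  ∎
    where
    v : V
    v = ι (i , k)
    v∈P₀ : S v ≡ [ 0 ]
    v∈P₀ = S-ι (i , k)
    first-steps : f₂ (f₂ v) ≡ bumpi (bumpi v)
    first-steps = trans (cong f₂ (f₂-P₀₁-k≢0 v (inj₁ v∈P₀) k≢0))
      (f₂-P₀₁-k≢0 (bumpi v) (inj₂ (S-iter-from bumpi-raises 0 1 v v∈P₀)) k≢0)

  F₂'-formula : ∀ i k → F₂' (i , k) ≡ (i ⊕ [ 2 ] ⊖ [ 2 ] ⊗ 𝟙≡ k [ 0 ] , k ⊖ [ 2 ])
  F₂'-formula i k = [ F₂'-k≡0 i k , F₂'-k≢0 i k ]′ (toSum (k ≟ [ 0 ]))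

  F₀-formula : ∀ i k → F₀ (i , k) ≡ ι (i ⊖ [ 2 ] ⊕ 𝟙≡ k [ 0 ] , k ⊕ [ 1 ])
  F₀-formula i k = trans (returns-to-P₀ f₀-raises (i , k)) (cong ι (F₀'-formula i k))

  F₁-formula : ∀ i k → F₁ (i , k) ≡ ι (i ⊕ 𝟙≡ k (⊝ [ 1 ]) , k ⊕ [ 1 ])
  F₁-formula i k = trans (returns-to-P₀ f₁-raises (i , k)) (cong ι (F₁'-formula i k))

  F₂-formula : ∀ i k → F₂ (i , k) ≡ ι (i ⊕ [ 2 ] ⊖ [ 2 ] ⊗ 𝟙≡ k [ 0 ] , k ⊖ [ 2 ])
  F₂-formula i k = trans (returns-to-P₀ f₂-raises (i , k)) (cong ι (F₂'-formula i k))

  ψ₀-conj : ∀ p → ψ₀ (F₀' p) ≡ O (ψ₀ p)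
  ψ₀-conj (i , k) = begin
    ψ₀ (F₀' (i , k))
      ≡⟨ cong ψ₀ (F₀'-formula i k) ⟩
    (k ⊕ [ 1 ] , i ⊖ [ 2 ] ⊕ e ⊕ [ 2 ] ⊗ (k ⊕ [ 1 ]))
      ≡⟨ cong (k ⊕ [ 1 ] ,_) (solve 3 (λ i k e → i :- con (+ 2) :+ e :+ con (+ 2) :* (k :+ con (+ 1))
                                                := i :+ con (+ 2) :* k :+ e) refl i k e) ⟩
    O (ψ₀ (i , k))
      ∎
    where
    e : Zm
    e = 𝟙≡ k [ 0 ]

  ψ₁-conj : ∀ p → ψ₁ (F₁' p) ≡ O (ψ₁ p)
  ψ₁-conj (i , k) = begin
    ψ₁ (F₁' (i , k))                          ≡⟨ cong ψ₁ (F₁'-formula i k) ⟩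
    (k ⊕ [ 1 ] ⊕ [ 1 ] , i ⊕ 𝟙≡ k (⊝ [ 1 ]))  ≡⟨ cong (λ e → k ⊕ [ 1 ] ⊕ [ 1 ] , i ⊕ e) (𝟙≡-cong (≡-[1]⇔⊕[1]≡[0] {k})) ⟩
    O (ψ₁ (i , k))                            ∎

  ψ₂-conj : ∀ λ' → λ' ⊗ (⊝ [ 2 ]) ≡ [ 1 ] → ∀ p → ψ₂ λ' (F₂' p) ≡ O (ψ₂ λ' p)
  ψ₂-conj λ' λ'⊗-2≡1 (i , k) = begin
    ψ₂ λ' (F₂' (i , k))                                               ≡⟨ cong (ψ₂ λ') (F₂'-formula i k) ⟩
    (λ' ⊗ (k ⊖ [ 2 ]) , λ' ⊗ (i ⊕ [ 2 ] ⊖ [ 2 ] ⊗ e ⊕ (k ⊖ [ 2 ])))  ≡⟨ cong₂ _,_ first second ⟩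
    O (ψ₂ λ' (i , k))                                                 ∎
    where
    e : Zm
    e = 𝟙≡ k [ 0 ]
    first : λ' ⊗ (k ⊖ [ 2 ]) ≡ λ' ⊗ k ⊕ [ 1 ]
    first = begin
      λ' ⊗ (k ⊖ [ 2 ])            ≡⟨ solve 2 (λ l k → l :* (k :- con (+ 2)) := l :* k :+ l :* (:- con (+ 2))) refl λ' k ⟩
      λ' ⊗ k ⊕ λ' ⊗ ⊝ [ 2 ]       ≡⟨ cong (λ' ⊗ k ⊕_) λ'⊗-2≡1 ⟩
      λ' ⊗ k ⊕ [ 1 ]              ∎
    second : λ' ⊗ (i ⊕ [ 2 ] ⊖ [ 2 ] ⊗ e ⊕ (k ⊖ [ 2 ])) ≡ λ' ⊗ (i ⊕ k) ⊕ 𝟙≡ (λ' ⊗ k) [ 0 ]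
    second = begin
      λ' ⊗ (i ⊕ [ 2 ] ⊖ [ 2 ] ⊗ e ⊕ (k ⊖ [ 2 ]))
        ≡⟨ solve 4 (λ l i k e → l :* (i :+ con (+ 2) :- con (+ 2) :* e :+ (k :- con (+ 2)))
                                := l :* (i :+ k) :+ l :* (:- con (+ 2)) :* e) refl λ' i k e ⟩
      λ' ⊗ (i ⊕ k) ⊕ λ' ⊗ ⊝ [ 2 ] ⊗ e
        ≡⟨ cong (λ u → λ' ⊗ (i ⊕ k) ⊕ u ⊗ e) λ'⊗-2≡1 ⟩
      λ' ⊗ (i ⊕ k) ⊕ [ 1 ] ⊗ e
        ≡⟨ cong (λ' ⊗ (i ⊕ k) ⊕_) (*-identityˡ e) ⟩
      λ' ⊗ (i ⊕ k) ⊕ e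
        ≡⟨ cong (λ' ⊗ (i ⊕ k) ⊕_) (𝟙≡-cong (≡[0]⇔unit⊗≡[0] λ' (⊝ [ 2 ]) λ'⊗-2≡1 k)) ⟩
      λ' ⊗ (i ⊕ k) ⊕ 𝟙≡ (λ' ⊗ k) [ 0 ]
        ∎

-- Oddness of m is what makes λ' exist; given λ', only λ' ⊗ (⊝ [ 2 ]) ≡ [ 1 ] is used.
proposition3p4 : (m : ℕ) .{{_ : NonZero m}} → 3 ≤ m →
    let open Zmod m in
    (∀ i k → F₀ (i , k) ≡ ι (i ⊖ [ 2 ] ⊕ 𝟙≡ k [ 0 ] , k ⊕ [ 1 ]))
    × (∀ i k → F₁ (i , k) ≡ ι (i ⊕ 𝟙≡ k (⊝ [ 1 ]) , k ⊕ [ 1 ]))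
    × (∀ i k → F₂ (i , k) ≡ ι (i ⊕ [ 2 ] ⊖ [ 2 ] ⊗ 𝟙≡ k [ 0 ] , k ⊖ [ 2 ]))
    × (¬ (2 ∣ m) → ∀ (λ' : Zm) → λ' ⊗ (⊝ [ 2 ]) ≡ [ 1 ] →
        (∀ p → ψ₀ (F₀' p) ≡ O (ψ₀ p))
        × (∀ p → ψ₁ (F₁' p) ≡ O (ψ₁ p))
        × (∀ p → ψ₂ λ' (F₂' p) ≡ O (ψ₂ λ' p)))
proposition3p4 (suc zero) (s≤s ())
proposition3p4 (suc (suc r)) _ =
  F₀-formula , F₁-formula , F₂-formula ,
  λ _ λ' λ'⊗-2≡1 → ψ₀-conj , ψ₁-conj , ψ₂-conj λ' λ'⊗-2≡1
  where open ReturnMaps r
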